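{- If a simplicial complex $K$ with $\dim(K) = d$ is nice on $[n]$, then $d+2 \leq n \leq 2d+3$.
   Context: A simplicial complex $K$ with vertex set identified with a subset of $[n]=\{1,\dots,n\}$ is nice on $[n]$ if for every subset $F \subseteq [n]$ exactly one of $F$ and $[n]\setminus F$ belongs to $K$. Simplicial complexes are nonempty, so they contain $\emptyset$. -}

module Defs where

open import Data.Nat using (ℕ)
open import Data.Integer using (ℤ; +_; _+_; _≤_)
open import Data.Fin.Subset using (Subset; ⊥; ∁; _⊆_; ∣_∣)
open import Data.Product using (_×_; Σ)
open import Data.Sum using (_⊎_)
open import Relation.Nullary using (¬_)
open import Relation.Binary.PropositionalEquality using (_≡_)

record SimplicialComplex (n : ℕ) : Set₁ where
  field
    face      : Subset n → Set
    empty∈    : face ⊥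
    downClosed : ∀ {F G} → face F → G ⊆ F → face G

open SimplicialComplex public

Nice : ∀ {n} → SimplicialComplex n → Set
Nice K = ∀ F → (face K F ⊎ face K (∁ F)) × ¬ (face K F × face K (∁ F))

-- dim K = d : the maximum of |F| - 1 over faces F equals d (d ∈ ℤ, so d = -1 allowed).
HasDim : ∀ {n} → SimplicialComplex n → ℤ → Set
HasDim K d =
  (Σ _ λ F → face K F × (+ ∣ F ∣ ≡ d + + 1)) ×
  (∀ F → face K F → + ∣ F ∣ ≤ d + + 1)

-- Since ∅ is a face, its complement [n] is not, so every face misses a vertex: n ≥ d + 2.
-- Splitting [n] into two halves of sizes ⌊n/2⌋ and ⌈n/2⌉, one of them is a face,
-- so d + 1 ≥ ⌊n/2⌋, i.e. n ≤ 2d + 3.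
module Submission where

open import Defs
open import Data.Nat using (ℕ; zero; suc; _<_; s≤s; z≤n)
open import Data.Integer using (ℤ; +_; _+_; _*_; _≤_)
open import Data.Product using (_×_; _,_; Σ; proj₁; proj₂)
open import Data.Sum using (inj₁; inj₂)

import Data.Nat as ℕ
import Data.Nat.Properties as ℕ
import Data.Integer as ℤ
import Data.Integer.Properties as ℤ
open import Data.Integer.Tactic.RingSolver using (solve-∀)
open import Data.Fin.Subset using (Subset; inside; outside; ∁; ⊤; ∣_∣) renaming (⊥ to ∅)
open import Data.Fin.Subset.Properties using (∣p∣≤n; ∣p∣≡n⇒p≡⊤; ∪-∩-booleanAlgebra)
open import Algebra.Lattice.Properties.BooleanAlgebra using (¬⊥≈⊤)
open import Data.Vec using ([]; _∷_)
open import Relation.Nullary using (¬_; contradiction)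
open import Relation.Binary.PropositionalEquality
  using (_≡_; sym; cong; subst; module ≡-Reasoning)

halving : ∀ n → Subset n
halving zero          = []
halving (suc zero)    = outside ∷ []
halving (suc (suc n)) = inside ∷ outside ∷ halving n

halving-balanced : ∀ n → n ℕ.≤ 2 ℕ.* ∣ halving n ∣ ℕ.+ 1 × n ℕ.≤ 2 ℕ.* ∣ ∁ (halving n) ∣ ℕ.+ 1
halving-balanced zero          = z≤n , z≤n
halving-balanced (suc zero)    = s≤s z≤n , s≤s z≤n
halving-balanced (suc (suc n)) with halving-balanced n
... | H-large , ∁H-large = grow H-large , grow ∁H-large
  where
  grow : ∀ {k} → n ℕ.≤ 2 ℕ.* k ℕ.+ 1 → suc (suc n) ℕ.≤ 2 ℕ.* suc k ℕ.+ 1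
  grow {k} n≤2k+1 = subst (suc (suc n) ℕ.≤_) (cong (ℕ._+ 1) (sym (ℕ.*-suc 2 k))) (s≤s (s≤s n≤2k+1))

module _ {n : ℕ} (K : SimplicialComplex n) (nice : Nice K) where

  Nice⇒¬face-⊤ : ¬ face K ⊤
  Nice⇒¬face-⊤ ⊤∈K = proj₂ (nice ∅) (empty∈ K , subst (face K) (sym (¬⊥≈⊤ (∪-∩-booleanAlgebra n))) ⊤∈K)

  Nice⇒∣face∣<n : ∀ {F} → face K F → ∣ F ∣ < n
  Nice⇒∣face∣<n {F} F∈K with ℕ.m≤n⇒m<n∨m≡n (∣p∣≤n F)
  ... | inj₁ ∣F∣<n = ∣F∣<n
  ... | inj₂ ∣F∣≡n = contradiction (subst (face K) (∣p∣≡n⇒p≡⊤ ∣F∣≡n) F∈K) Nice⇒¬face-⊤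

  Nice⇒large-face : Σ (Subset n) λ G → face K G × n ℕ.≤ 2 ℕ.* ∣ G ∣ ℕ.+ 1
  Nice⇒large-face with proj₁ (nice (halving n)) | halving-balanced n
  ... | inj₁ H∈K  | H-large , _ = halving n , H∈K , H-large
  ... | inj₂ ∁H∈K | _ , ∁H-large = ∁ (halving n) , ∁H∈K , ∁H-large

m≡d+1∧m<n⇒d+2≤n : ∀ d {m n} → + m ≡ d + + 1 → m < n → d + + 2 ≤ + n
m≡d+1∧m<n⇒d+2≤n d {m} {n} m≡d+1 m<n = subst (_≤ + n) 1+m≡d+2 (ℤ.+≤+ m<n)
  where
  open ≡-Reasoning
  1+m≡d+2 : + suc m ≡ d + + 2
  1+m≡d+2 = begin
    + suc m         ≡⟨ cong +_ (ℕ.+-comm 1 m) ⟩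
    + (m ℕ.+ 1)     ≡⟨ ℤ.pos-+ m 1 ⟩
    + m + + 1       ≡⟨ cong (_+ + 1) m≡d+1 ⟩
    (d + + 1) + + 1 ≡⟨ ℤ.+-assoc d (+ 1) (+ 1) ⟩
    d + + 2         ∎

m≡d+1∧n≤2m+1⇒n≤2d+3 : ∀ d {m n} → + m ≡ d + + 1 → n ℕ.≤ 2 ℕ.* m ℕ.+ 1 → + n ≤ + 2 * d + + 3
m≡d+1∧n≤2m+1⇒n≤2d+3 d {m} {n} m≡d+1 n≤2m+1 = subst (+ n ≤_) 2m+1≡2d+3 (ℤ.+≤+ n≤2m+1)
  where
  open ≡-Reasoning
  2[d+1]+1≡2d+3 : ∀ d → + 2 * (d + + 1) + + 1 ≡ + 2 * d + + 3
  2[d+1]+1≡2d+3 = solve-∀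
  2m+1≡2d+3 : + (2 ℕ.* m ℕ.+ 1) ≡ + 2 * d + + 3
  2m+1≡2d+3 = begin
    + (2 ℕ.* m ℕ.+ 1)     ≡⟨ ℤ.pos-+ (2 ℕ.* m) 1 ⟩
    + (2 ℕ.* m) + + 1     ≡⟨ cong (_+ + 1) (ℤ.pos-* 2 m) ⟩
    + 2 * + m + + 1       ≡⟨ cong (λ x → + 2 * x + + 1) m≡d+1 ⟩
    + 2 * (d + + 1) + + 1 ≡⟨ 2[d+1]+1≡2d+3 d ⟩
    + 2 * d + + 3         ∎

mainTheorem13 : (n : ℕ) (K : SimplicialComplex n) (d : ℤ) →
                HasDim K d → Nice K →
                (d + + 2 ≤ + n) × (+ n ≤ + 2 * d + + 3)
mainTheorem13 n K d ((F , F∈K , ∣F∣≡d+1) , faces≤d+1) nice with Nice⇒large-face K nice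
... | G , G∈K , n≤2∣G∣+1 =
  m≡d+1∧m<n⇒d+2≤n d ∣F∣≡d+1 (Nice⇒∣face∣<n K nice F∈K) ,
  m≡d+1∧n≤2m+1⇒n≤2d+3 d ∣F∣≡d+1 (ℕ.≤-trans n≤2∣G∣+1 (ℕ.+-monoˡ-≤ 1 (ℕ.*-monoʳ-≤ 2 ∣G∣≤∣F∣)))
  where
  ∣G∣≤∣F∣ : ∣ G ∣ ℕ.≤ ∣ F ∣
  ∣G∣≤∣F∣ = ℤ.drop‿+≤+ (subst (+ ∣ G ∣ ≤_) (sym ∣F∣≡d+1) (faces≤d+1 G G∈K))
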